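{- The following rules (premise / conclusion) are admissible for $\mathsf{GLP_{NS}}+\mathsf{cut}$, i.e. whenever the premise is provable in $\mathsf{GLP_{NS}}+\mathsf{cut}$, so is the conclusion: (1) $\Gamma\{\emptyset\}$ / $\Gamma\{A\}$; (2) $\Gamma$ / $[\Gamma]_i$; (3) $\Gamma\{A\vee B\}$ / $\Gamma\{A,B\}$; (4) $\Gamma\{\bot\}$ / $\Gamma\{\emptyset\}$; (5) $\Gamma\{\Box_iA\}$ / $\Gamma\{[A]_i\}$. Here $\Gamma\{\ \}$ ranges over unary contexts (resp. $\Gamma$ over nested sequents), $A,B$ over formulas and $i$ over natural numbers.
   Context: Formulas are built from atoms $p$, complements $\overline{p}$, $\top,\bot$, $\wedge,\vee$, and $\Box_i,\Diamond_i$ ($i\in\mathbb{N}$); negation $\overline{A}$ is defined via De Morgan laws, $\overline{\overline{p}}=p$, $\overline{\top}=\bot$, $\overline{\bot}=\top$, $\overline{\Box_iA}=\Diamond_i\overline{A}$, $\overline{\Diamond_iA}=\Box_i\overline{A}$. A nested sequent is (inductively) a finite multiset of formulas and of expressions $[\Delta]_i$ with $\Delta$ a nested sequent and $i\in\mathbb{N}$. A unary context $\Gamma\{\ \}$ is a nested sequent with one hole in place of a formula; $\Gamma\{\Upsilon\}$ fills the hole with $\Upsilon$, $\Gamma\{\emptyset\}$ with the empty sequent. $\mathsf{GLP_{NS}}$ has initial sequents $\Gamma\{p,\overline{p}\}$, $\Gamma\{\top\}$ and rules (premises / conclusion): $\Gamma\{A\}$, $\Gamma\{B\}$ / $\Gamma\{A\wedge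 B\}$; $\Gamma\{A,B\}$ / $\Gamma\{A\vee B\}$; $\Gamma\{[A,\Diamond_i\overline{A}]_i\}$ / $\Gamma\{\Box_iA\}$; $\Gamma\{\Diamond_iA,[A,\Delta]_j\}$ / $\Gamma\{\Diamond_iA,[\Delta]_j\}$ ($i\le j$); $\Gamma\{\Diamond_iA,[\Diamond_iA,\Delta]_j\}$ / $\Gamma\{\Diamond_iA,[\Delta]_j\}$ ($i\le j$); $\Gamma\{\Diamond_iA,[\Diamond_iA,\Delta]_j\}$ / $\Gamma\{[\Diamond_iA,\Delta]_j\}$ ($i<j$). $\mathsf{GLP_{NS}}+\mathsf{cut}$ adds the rule $\Gamma\{A\}$, $\Gamma\{\overline{A}\}$ / $\Gamma\{\emptyset\}$ for arbitrary formulas $A$. -}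

module Defs where

open import Data.Nat using (ℕ; _≤_; _<_)
open import Data.List using (List; []; _∷_; _++_)

-- Formulas in negation normal form; atoms indexed by ℕ.
data Fm : Set where
  at nat  : ℕ → Fm          -- p and its complement p̄
  ⊤' ⊥'   : Fm
  _∧'_ _∨'_ : Fm → Fm → Fm
  □ ◇     : ℕ → Fm → Fm

neg : Fm → Fm
neg (at p)   = nat p
neg (nat p)  = at p
neg ⊤'       = ⊥'
neg ⊥'       = ⊤'
neg (A ∧' B) = neg A ∨' neg B
neg (A ∨' B) = neg A ∧' neg B
neg (□ i A)  = ◇ i (neg A)
neg (◇ i A)  = □ i (neg A)

-- Nested sequents: finite multisets (lists modulo nested permutation, see _≈_)
-- of formulas and bracketed nested sequents [Δ]_i.
data Item : Set where
  fm  : Fm → Item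
  box : ℕ → List Item → Item

Seq : Set
Seq = List Item

-- Unary contexts Γ{ }: the hole sits either at the top level next to Γ,
-- or inside a bracket [C]_i that sits next to Γ.  Up to multiset equality
-- these are exactly all nested sequents with one hole.
data Ctx : Set where
  hole   : Seq → Ctx
  inside : Seq → ℕ → Ctx → Ctx

_⟪_⟫ : Ctx → Seq → Seq
hole Γ       ⟪ Υ ⟫ = Υ ++ Γ
inside Γ i C ⟪ Υ ⟫ = box i (C ⟪ Υ ⟫) ∷ Γ

data _≈ᵢ_ : Item → Item → Set
data _≈_ : Seq → Seq → Set

data _≈ᵢ_ where
  fm≈  : ∀ A → fm A ≈ᵢ fm A
  box≈ : ∀ i {Δ Δ'} → Δ ≈ Δ' → box i Δ ≈ᵢ box i Δ'

data _≈_ where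
  []≈   : [] ≈ []
  ∷≈    : ∀ {x y xs ys} → x ≈ᵢ y → xs ≈ ys → (x ∷ xs) ≈ (y ∷ ys)
  swap≈ : ∀ x y xs → (x ∷ y ∷ xs) ≈ (y ∷ x ∷ xs)
  trans≈ : ∀ {xs ys zs} → xs ≈ ys → ys ≈ zs → xs ≈ zs

-- Derivability in GLP_NS + cut.  The constructor `mset` only expresses that
-- sequents are multisets (derivability respects multiset equality).
data ⊢_ : Seq → Set where
  ax    : ∀ Γ p → ⊢ (Γ ⟪ fm (at p) ∷ fm (nat p) ∷ [] ⟫)
  top   : ∀ Γ → ⊢ (Γ ⟪ fm ⊤' ∷ [] ⟫)
  ∧R    : ∀ Γ A B → ⊢ (Γ ⟪ fm A ∷ [] ⟫) → ⊢ (Γ ⟪ fm B ∷ [] ⟫)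
        → ⊢ (Γ ⟪ fm (A ∧' B) ∷ [] ⟫)
  ∨R    : ∀ Γ A B → ⊢ (Γ ⟪ fm A ∷ fm B ∷ [] ⟫) → ⊢ (Γ ⟪ fm (A ∨' B) ∷ [] ⟫)
  □R    : ∀ Γ i A → ⊢ (Γ ⟪ box i (fm A ∷ fm (◇ i (neg A)) ∷ []) ∷ [] ⟫)
        → ⊢ (Γ ⟪ fm (□ i A) ∷ [] ⟫)
  ◇R    : ∀ Γ i j A Δ → i ≤ j
        → ⊢ (Γ ⟪ fm (◇ i A) ∷ box j (fm A ∷ Δ) ∷ [] ⟫)
        → ⊢ (Γ ⟪ fm (◇ i A) ∷ box j Δ ∷ [] ⟫)
  ◇prop : ∀ Γ i j A Δ → i ≤ j
        → ⊢ (Γ ⟪ fm (◇ i A) ∷ box j (fm (◇ i A) ∷ Δ) ∷ [] ⟫)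
        → ⊢ (Γ ⟪ fm (◇ i A) ∷ box j Δ ∷ [] ⟫)
  ◇lift : ∀ Γ i j A Δ → i < j
        → ⊢ (Γ ⟪ fm (◇ i A) ∷ box j (fm (◇ i A) ∷ Δ) ∷ [] ⟫)
        → ⊢ (Γ ⟪ box j (fm (◇ i A) ∷ Δ) ∷ [] ⟫)
  cut   : ∀ Γ A → ⊢ (Γ ⟪ fm A ∷ [] ⟫) → ⊢ (Γ ⟪ fm (neg A) ∷ [] ⟫)
        → ⊢ (Γ ⟪ [] ⟫)
  mset  : ∀ {S S'} → S ≈ S' → ⊢ S → ⊢ S'

module Submission where

-- Every derivation of S is turned into one of T by
--    induction on the derivation; the key lemma `insert-split-plug` says that
--    an insertion into Γ{X} either lands in the context Γ (so the rule is
--    re-applied in a larger context) or strictly inside a bracket of the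
--    active part X (only possible for the ◇-rules, whose boxes absorb it).
-- 3. Necessitation: every rule instance in context Γ is an instance in the
--    context [Γ]_i, so a derivation can be wrapped in a bracket.
-- 4. Generalised identity Γ{A, Ā} for every formula, by induction on A.
-- 5. The three inversion rules follow by one cut each: against ⊤ for ⊥,
--    against Ā∧B̄ for A∨B and against ◇_iĀ for □_iA, the other cut premise
--    being an instance of weakening and identity.

open import Defs
open import Data.Nat using (ℕ)
open import Data.Nat.Properties using (≤-refl)
open import Data.List using ([]; _∷_; _++_)
open import Data.List.Properties using (++-identityʳ; ++-assoc)
open import Data.Product using (_×_; Σ; _,_)
open import Data.Sum using (_⊎_; inj₁; inj₂)
open import Relation.Binary.PropositionalEquality using (_≡_; refl; subst; sym; cong; cong₂)

≈ᵢ-refl : ∀ x → x ≈ᵢ x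
≈-refl  : ∀ S → S ≈ S
≈ᵢ-refl (fm A)    = fm≈ A
≈ᵢ-refl (box i Δ) = box≈ i (≈-refl Δ)
≈-refl []      = []≈
≈-refl (x ∷ S) = ∷≈ (≈ᵢ-refl x) (≈-refl S)

≈-++ʳ : ∀ {Y Y'} → Y ≈ Y' → ∀ G → (Y ++ G) ≈ (Y' ++ G)
≈-++ʳ []≈            G = ≈-refl G
≈-++ʳ (∷≈ p q)       G = ∷≈ p (≈-++ʳ q G)
≈-++ʳ (swap≈ x y xs) G = swap≈ x y (xs ++ G)
≈-++ʳ (trans≈ p q)   G = trans≈ (≈-++ʳ p G) (≈-++ʳ q G)

≈-plug : ∀ Γ {Y Y'} → Y ≈ Y' → (Γ ⟪ Y ⟫) ≈ (Γ ⟪ Y' ⟫)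
≈-plug (hole G)       p = ≈-++ʳ p G
≈-plug (inside G i C) p = ∷≈ (box≈ i (≈-plug C p)) (≈-refl G)

≈-move : ∀ x G X → (X ++ x ∷ G) ≈ (x ∷ X ++ G)
≈-move x G []      = ≈-refl _
≈-move x G (y ∷ X) = trans≈ (∷≈ (≈ᵢ-refl y) (≈-move x G X)) (swap≈ y x _)

≈-rotate : ∀ a b c → (a ∷ b ∷ c ∷ []) ≈ (b ∷ c ∷ a ∷ [])
≈-rotate a b c = trans≈ (swap≈ a b _) (∷≈ (≈ᵢ-refl b) (swap≈ a c []))

permute : ∀ Γ {Y Y'} → Y ≈ Y' → ⊢ (Γ ⟪ Y ⟫) → ⊢ (Γ ⟪ Y' ⟫)
permute Γ p = mset (≈-plug Γ p)

data Insert (x : Item) : Seq → Seq → Set where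
  here  : ∀ {S} → Insert x S (x ∷ S)
  there : ∀ {y S T} → Insert x S T → Insert x (y ∷ S) (y ∷ T)
  deep  : ∀ {i Δ Δ' S} → Insert x Δ Δ' → Insert x (box i Δ ∷ S) (box i Δ' ∷ S)

data InsertBelow (x : Item) : Seq → Seq → Set where
  there : ∀ {y S T} → InsertBelow x S T → InsertBelow x (y ∷ S) (y ∷ T)
  deep  : ∀ {i Δ Δ' S} → Insert x Δ Δ' → InsertBelow x (box i Δ ∷ S) (box i Δ' ∷ S)

insert-++ʳ : ∀ {x Y Y'} → Insert x Y Y' → ∀ G → Insert x (Y ++ G) (Y' ++ G)
insert-++ʳ here      G = here
insert-++ʳ (there a) G = there (insert-++ʳ a G)
insert-++ʳ (deep a)  G = deep a

insert-++ˡ : ∀ {x G G'} Y → Insert x G G' → Insert x (Y ++ G) (Y ++ G')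
insert-++ˡ []      a = a
insert-++ˡ (y ∷ Y) a = there (insert-++ˡ Y a)

insert-plug : ∀ {x} Γ {Y Y'} → Insert x Y Y' → Insert x (Γ ⟪ Y ⟫) (Γ ⟪ Y' ⟫)
insert-plug (hole G)       a = insert-++ʳ a G
insert-plug (inside G i Γ) a = deep (insert-plug Γ a)

insert-resp-≈ : ∀ {x S S' T'} → S ≈ S' → Insert x S' T' →
                Σ Seq λ T → Insert x S T × (T ≈ T')
insert-resp-≈ {x} []≈ here = _ , here , ≈-refl _
insert-resp-≈ {x} (∷≈ p q) here = _ , here , ∷≈ (≈ᵢ-refl x) (∷≈ p q)
insert-resp-≈ (∷≈ p q) (there a) with insert-resp-≈ q a
... | T , a' , e = _ , there a' , ∷≈ p e
insert-resp-≈ (∷≈ (box≈ i r) q) (deep a) with insert-resp-≈ r a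
... | D , a' , e = _ , deep a' , ∷≈ (box≈ i e) q
insert-resp-≈ {x} (swap≈ a b xs) here = _ , here , ∷≈ (≈ᵢ-refl x) (swap≈ a b xs)
insert-resp-≈ {x} (swap≈ a b xs) (there here) =
  _ , here , trans≈ (∷≈ (≈ᵢ-refl x) (swap≈ a b xs)) (swap≈ x b (a ∷ xs))
insert-resp-≈ (swap≈ a b xs) (there (there r)) = _ , there (there r) , swap≈ _ _ _
insert-resp-≈ (swap≈ a b xs) (there (deep r))  = _ , deep r , swap≈ _ _ _
insert-resp-≈ (swap≈ a b xs) (deep r)          = _ , there (deep r) , swap≈ _ _ _
insert-resp-≈ (trans≈ p q) a with insert-resp-≈ q a
... | U , a₁ , e₁ with insert-resp-≈ p a₁
... | T , a₂ , e₂ = T , a₂ , trans≈ e₂ e₁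

insert-split-++ : ∀ {x} X G {T} → Insert x (X ++ G) T →
  (Σ Seq λ G' → ((X ++ G') ≈ T) × Insert x G G')
  ⊎ (Σ Seq λ X' → InsertBelow x X X' × ((X' ++ G) ≈ T))
insert-split-++ [] G a = inj₁ (_ , ≈-refl _ , a)
insert-split-++ {x} (y ∷ X) G here = inj₁ (x ∷ G , ≈-move x G (y ∷ X) , here)
insert-split-++ (y ∷ X) G (there a) with insert-split-++ X G a
... | inj₁ (G' , e , a') = inj₁ (G' , ∷≈ (≈ᵢ-refl y) e , a')
... | inj₂ (X' , b , e)  = inj₂ (y ∷ X' , there b , ∷≈ (≈ᵢ-refl y) e)
insert-split-++ (y ∷ X) G (deep a) = inj₂ (_ , deep a , ≈-refl _)

insert-split-plug : ∀ {x} Γ X {T} → Insert x (Γ ⟪ X ⟫) T →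
  (Σ Ctx λ Γ' → ((Γ' ⟪ X ⟫) ≈ T) × (∀ Y → Insert x (Γ ⟪ Y ⟫) (Γ' ⟪ Y ⟫)))
  ⊎ (Σ Seq λ X' → InsertBelow x X X' × ((Γ ⟪ X' ⟫) ≈ T))
insert-split-plug (hole G) X a with insert-split-++ X G a
... | inj₁ (G' , e , a') = inj₁ (hole G' , e , λ Y → insert-++ˡ Y a')
... | inj₂ r = inj₂ r
insert-split-plug {x} (inside G i Γ) X here =
  inj₁ (inside (x ∷ G) i Γ , swap≈ _ _ _ , λ Y → there here)
insert-split-plug (inside G i Γ) X (there {T = G'} a) =
  inj₁ (inside G' i Γ , ≈-refl _ , λ Y → there a)
insert-split-plug (inside G i Γ) X (deep a) with insert-split-plug Γ X a
... | inj₁ (Γ' , e , f) = inj₁ (inside G i Γ' , ∷≈ (box≈ i e) (≈-refl G) , λ Y → deep (f Y))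
... | inj₂ (X' , b , e) = inj₂ (X' , b , ∷≈ (box≈ i e) (≈-refl G))

-- If the new
-- item goes into the context, the last rule is re-applied in the larger
-- context; otherwise it goes inside an active bracket, which only the
-- ◇-rules have, and it is placed in the same bracket of the premise.
weakening : ∀ {x S T} → ⊢ S → Insert x S T → ⊢ T
weakening (ax Γ p) a with insert-split-plug Γ _ a
... | inj₁ (Γ' , e , f) = mset e (ax Γ' p)
... | inj₂ (_ , there (there ()) , _)
weakening (top Γ) a with insert-split-plug Γ _ a
... | inj₁ (Γ' , e , f) = mset e (top Γ')
... | inj₂ (_ , there () , _)
weakening (∧R Γ A B d₁ d₂) a with insert-split-plug Γ _ a
... | inj₁ (Γ' , e , f) = mset e (∧R Γ' A B (weakening d₁ (f _)) (weakening d₂ (f _)))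
... | inj₂ (_ , there () , _)
weakening (∨R Γ A B d) a with insert-split-plug Γ _ a
... | inj₁ (Γ' , e , f) = mset e (∨R Γ' A B (weakening d (f _)))
... | inj₂ (_ , there () , _)
weakening (□R Γ i A d) a with insert-split-plug Γ _ a
... | inj₁ (Γ' , e , f) = mset e (□R Γ' i A (weakening d (f _)))
... | inj₂ (_ , there () , _)
weakening (◇R Γ i j A Δ le d) a with insert-split-plug Γ _ a
... | inj₁ (Γ' , e , f) = mset e (◇R Γ' i j A Δ le (weakening d (f _)))
... | inj₂ (_ , there (deep a') , e) =
  mset e (◇R Γ i j A _ le (weakening d (insert-plug Γ (there (deep (there a'))))))
... | inj₂ (_ , there (there ()) , _)
weakening (◇prop Γ i j A Δ le d) a with insert-split-plug Γ _ a
... | inj₁ (Γ' , e , f) = mset e (◇prop Γ' i j A Δ le (weakening d (f _)))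
... | inj₂ (_ , there (deep a') , e) =
  mset e (◇prop Γ i j A _ le (weakening d (insert-plug Γ (there (deep (there a'))))))
... | inj₂ (_ , there (there ()) , _)
weakening {x} (◇lift Γ i j A Δ le d) a with insert-split-plug Γ _ a
... | inj₁ (Γ' , e , f) = mset e (◇lift Γ' i j A Δ le (weakening d (f _)))
... | inj₂ (_ , deep here , e) =
  mset (trans≈ (≈-plug Γ (∷≈ (box≈ j (swap≈ _ _ _)) []≈)) e)
       (◇lift Γ i j A (x ∷ Δ) le (weakening d (insert-plug Γ (there (deep (there here))))))
... | inj₂ (_ , deep (there a') , e) =
  mset e (◇lift Γ i j A _ le (weakening d (insert-plug Γ (there (deep (there a'))))))
... | inj₂ (_ , there () , _)
weakening (cut Γ A d₁ d₂) a with insert-split-plug Γ _ a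
... | inj₁ (Γ' , e , f) = mset e (cut Γ' A (weakening d₁ (f _)) (weakening d₂ (f _)))
... | inj₂ (_ , () , _)
weakening (mset p d) a with insert-resp-≈ p a
... | T , a' , e = mset e (weakening d a')

weaken : ∀ {x} Γ {Y Y'} → Insert x Y Y' → ⊢ (Γ ⟪ Y ⟫) → ⊢ (Γ ⟪ Y' ⟫)
weaken Γ a d = weakening d (insert-plug Γ a)

weaken-right : ∀ Γ Y Z → ⊢ (Γ ⟪ Y ⟫) → ⊢ (Γ ⟪ Y ++ Z ⟫)
weaken-right Γ Y []      d rewrite ++-identityʳ Y = d
weaken-right Γ Y (z ∷ Z) d = weaken Γ (insert-++ˡ Y here) (weaken-right Γ Y Z d)

-- A rule applied in context Γ is the same rule applied in context [Γ]_i.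
necessitation : ∀ {S} i → ⊢ S → ⊢ (box i S ∷ [])
necessitation i (ax Γ p)                = ax (inside [] i Γ) p
necessitation i (top Γ)                 = top (inside [] i Γ)
necessitation i (∧R Γ A B d₁ d₂)        = ∧R (inside [] i Γ) A B (necessitation i d₁) (necessitation i d₂)
necessitation i (∨R Γ A B d)            = ∨R (inside [] i Γ) A B (necessitation i d)
necessitation i (□R Γ k A d)            = □R (inside [] i Γ) k A (necessitation i d)
necessitation i (◇R Γ k j A Δ le d)     = ◇R (inside [] i Γ) k j A Δ le (necessitation i d)
necessitation i (◇prop Γ k j A Δ le d)  = ◇prop (inside [] i Γ) k j A Δ le (necessitation i d)
necessitation i (◇lift Γ k j A Δ le d)  = ◇lift (inside [] i Γ) k j A Δ le (necessitation i d)
necessitation i (cut Γ A d₁ d₂)         = cut (inside [] i Γ) A (necessitation i d₁) (necessitation i d₂)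
necessitation i (mset p d)              = mset (∷≈ (box≈ i p) []≈) (necessitation i d)

extend : Seq → Ctx → Ctx
extend Z (hole G)       = hole (Z ++ G)
extend Z (inside G i C) = inside G i (extend Z C)

plug-extend : ∀ Z Γ Y → (extend Z Γ ⟪ Y ⟫) ≡ (Γ ⟪ Y ++ Z ⟫)
plug-extend Z (hole G)       Y = sym (++-assoc Y Z G)
plug-extend Z (inside G i C) Y = cong (λ S → box i S ∷ G) (plug-extend Z C Y)

to-extend : ∀ Z Γ Y → ⊢ (Γ ⟪ Y ++ Z ⟫) → ⊢ (extend Z Γ ⟪ Y ⟫)
to-extend Z Γ Y = subst ⊢_ (sym (plug-extend Z Γ Y))

from-extend : ∀ Z Γ Y → ⊢ (extend Z Γ ⟪ Y ⟫) → ⊢ (Γ ⟪ Y ++ Z ⟫)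
from-extend Z Γ Y = subst ⊢_ (plug-extend Z Γ Y)

∧R-beside : ∀ Γ Z A B → ⊢ (Γ ⟪ fm A ∷ Z ⟫) → ⊢ (Γ ⟪ fm B ∷ Z ⟫) → ⊢ (Γ ⟪ fm (A ∧' B) ∷ Z ⟫)
∧R-beside Γ Z A B d₁ d₂ =
  from-extend Z Γ _ (∧R (extend Z Γ) A B (to-extend Z Γ _ d₁) (to-extend Z Γ _ d₂))

∨R-beside : ∀ Γ Z A B → ⊢ (Γ ⟪ fm A ∷ fm B ∷ Z ⟫) → ⊢ (Γ ⟪ fm (A ∨' B) ∷ Z ⟫)
∨R-beside Γ Z A B d = from-extend Z Γ _ (∨R (extend Z Γ) A B (to-extend Z Γ _ d))

□R-beside : ∀ Γ Z i A → ⊢ (Γ ⟪ box i (fm A ∷ fm (◇ i (neg A)) ∷ []) ∷ Z ⟫)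
          → ⊢ (Γ ⟪ fm (□ i A) ∷ Z ⟫)
□R-beside Γ Z i A d = from-extend Z Γ _ (□R (extend Z Γ) i A (to-extend Z Γ _ d))

cut-beside : ∀ Γ Z A → ⊢ (Γ ⟪ fm A ∷ Z ⟫) → ⊢ (Γ ⟪ fm (neg A) ∷ Z ⟫) → ⊢ (Γ ⟪ Z ⟫)
cut-beside Γ Z A d₁ d₂ =
  from-extend Z Γ [] (cut (extend Z Γ) A (to-extend Z Γ _ d₁) (to-extend Z Γ _ d₂))

beside : Item → ℕ → Ctx → Ctx
beside z i (hole G)       = inside (z ∷ G) i (hole [])
beside z i (inside G j C) = inside G j (beside z i C)

plug-beside : ∀ z i Γ Y → ((beside z i Γ) ⟪ Y ⟫) ≈ (Γ ⟪ z ∷ box i Y ∷ [] ⟫)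
plug-beside z i (hole G) Y rewrite ++-identityʳ Y = swap≈ _ _ _
plug-beside z i (inside G j C) Y = ∷≈ (box≈ j (plug-beside z i C Y)) (≈-refl G)

neg-involutive : ∀ A → neg (neg A) ≡ A
neg-involutive (at p)   = refl
neg-involutive (nat p)  = refl
neg-involutive ⊤'       = refl
neg-involutive ⊥'       = refl
neg-involutive (A ∧' B) = cong₂ _∧'_ (neg-involutive A) (neg-involutive B)
neg-involutive (A ∨' B) = cong₂ _∨'_ (neg-involutive A) (neg-involutive B)
neg-involutive (□ i A)  = cong (□ i) (neg-involutive A)
neg-involutive (◇ i A)  = cong (◇ i) (neg-involutive A)

Identity : Fm → Set
Identity A = ∀ Γ → ⊢ (Γ ⟪ fm A ∷ fm (neg A) ∷ [] ⟫)

identity-flipped : ∀ {A} → Identity A → ∀ Γ → ⊢ (Γ ⟪ fm (neg A) ∷ fm A ∷ [] ⟫)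
identity-flipped idA Γ = permute Γ (swap≈ _ _ []) (idA Γ)

identity-neg : ∀ A → Identity A → Identity (neg A)
identity-neg A idA Γ =
  subst (λ F → ⊢ (Γ ⟪ fm (neg A) ∷ fm F ∷ [] ⟫)) (sym (neg-involutive A)) (identity-flipped idA Γ)

∨-refutation : ∀ Γ A B → Identity A → Identity B
             → ⊢ (Γ ⟪ fm (neg (A ∨' B)) ∷ fm A ∷ fm B ∷ [] ⟫)
∨-refutation Γ A B idA idB = ∧R-beside Γ (fm A ∷ fm B ∷ []) (neg A) (neg B)
  (weaken-right Γ (fm (neg A) ∷ fm A ∷ []) (fm B ∷ []) (identity-flipped idA Γ))
  (weaken Γ (there here) (identity-flipped idB Γ))

identity-∨ : ∀ A B → Identity A → Identity B → Identity (A ∨' B)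
identity-∨ A B idA idB Γ = ∨R-beside Γ (fm (neg (A ∨' B)) ∷ []) A B
  (permute Γ (≈-rotate _ _ _) (∨-refutation Γ A B idA idB))

-- Γ{□_iA, ◇_iĀ}: after □R, the ◇-rule moves Ā into the new bracket, where
-- it meets A.
identity-□ : ∀ i A → Identity A → Identity (□ i A)
identity-□ i A idA Γ = □R-beside Γ (◇A̅ ∷ []) i A
  (permute Γ (swap≈ _ _ [])
    (◇R Γ i i (neg A) (fm A ∷ ◇A̅ ∷ []) ≤-refl
      (mset (plug-beside ◇A̅ i Γ _)
        (weaken-right (beside ◇A̅ i Γ) (fm (neg A) ∷ fm A ∷ []) (◇A̅ ∷ [])
          (identity-flipped idA (beside ◇A̅ i Γ))))))
  where ◇A̅ = fm (◇ i (neg A))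

-- Every formula has identity; the dual connectives reduce to ∨ and □ via
-- identity-neg.
identity : ∀ A → Identity A
identity (at p)   = λ Γ → ax Γ p
identity (nat p)  = identity-neg (at p) (identity (at p))
identity ⊤'       = λ Γ → weaken Γ (there here) (top Γ)
identity ⊥'       = identity-neg ⊤' (identity ⊤')
identity (A ∨' B) = identity-∨ A B (identity A) (identity B)
identity (A ∧' B) = subst Identity (cong₂ _∧'_ (neg-involutive A) (neg-involutive B))
  (identity-neg (neg A ∨' neg B)
    (identity-∨ (neg A) (neg B) (identity-neg A (identity A)) (identity-neg B (identity B))))
identity (□ i A)  = identity-□ i A (identity A)
identity (◇ i A)  = subst Identity (cong (◇ i) (neg-involutive A))
  (identity-neg (□ i (neg A)) (identity-□ i (neg A) (identity-neg A (identity A))))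

-- Invertibility of ∨, by a cut on A∨B with both A and B kept as side items.
∨-inversion : ∀ Γ A B → ⊢ (Γ ⟪ fm (A ∨' B) ∷ [] ⟫) → ⊢ (Γ ⟪ fm A ∷ fm B ∷ [] ⟫)
∨-inversion Γ A B d = cut-beside Γ (fm A ∷ fm B ∷ []) (A ∨' B)
  (weaken-right Γ (fm (A ∨' B) ∷ []) (fm A ∷ fm B ∷ []) d)
  (∨-refutation Γ A B (identity A) (identity B))

⊥-elimination : ∀ Γ → ⊢ (Γ ⟪ fm ⊥' ∷ [] ⟫) → ⊢ (Γ ⟪ [] ⟫)
⊥-elimination Γ = cut Γ ⊤' (top Γ)

-- Invertibility of □, by a cut on □_iA next to [A]_i; the other premise
-- Γ{◇_iĀ, [A]_i} comes from the ◇-rule and identity.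
□-inversion : ∀ Γ i A → ⊢ (Γ ⟪ fm (□ i A) ∷ [] ⟫) → ⊢ (Γ ⟪ box i (fm A ∷ []) ∷ [] ⟫)
□-inversion Γ i A d = cut-beside Γ ([A] ∷ []) (□ i A)
  (weaken-right Γ (fm (□ i A) ∷ []) ([A] ∷ []) d)
  (◇R Γ i i (neg A) (fm A ∷ []) ≤-refl
    (mset (plug-beside (fm (◇ i (neg A))) i Γ _)
      (identity-flipped (identity A) (beside (fm (◇ i (neg A))) i Γ))))
  where [A] = box i (fm A ∷ [])

lemma2 : (∀ (Γ : Ctx) (A : Fm) → ⊢ (Γ ⟪ [] ⟫) → ⊢ (Γ ⟪ fm A ∷ [] ⟫))
       × (∀ (Γ : Seq) (i : ℕ) → ⊢ Γ → ⊢ (box i Γ ∷ []))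
       × (∀ (Γ : Ctx) (A B : Fm) → ⊢ (Γ ⟪ fm (A ∨' B) ∷ [] ⟫) → ⊢ (Γ ⟪ fm A ∷ fm B ∷ [] ⟫))
       × (∀ (Γ : Ctx) → ⊢ (Γ ⟪ fm ⊥' ∷ [] ⟫) → ⊢ (Γ ⟪ [] ⟫))
       × (∀ (Γ : Ctx) (i : ℕ) (A : Fm) → ⊢ (Γ ⟪ fm (□ i A) ∷ [] ⟫) → ⊢ (Γ ⟪ box i (fm A ∷ []) ∷ [] ⟫))
lemma2 = (λ Γ A → weaken Γ here)
       , (λ Γ i → necessitation i)
       , ∨-inversion
       , ⊥-elimination
       , □-inversion
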